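{- Let $n$ be a positive integer and $m_1,m_2\in\{1,2,3\}$. The number of tilings of an $n$-board by half-squares, fences and combs in which the left slot of the last cell is filled by a tooth of a $(\frac12,\frac12;m_1)$-comb and the right slot of the last cell is filled by a tooth of a $(\frac12,\frac12;m_2)$-comb equals $T_{n+2-m_1}T_{n+2-m_2}$.
   Context: Tribonacci numbers: $T_n=T_{n-1}+T_{n-2}+T_{n-3}+\delta_{n,2}$ for all integers $n$, with $T_n=0$ for $n<2$; $\delta_{i,j}$ is $1$ if $i=j$ and $0$ otherwise. An $n$-board is a linear array of $n$ unit cells, each split into a left and a right slot of size $\frac12\times1$. A $(\frac12,\frac12;m)$-comb is a tile of $m$ teeth of size $\frac12\times1$ with consecutive teeth separated by gaps of size $\frac12\times1$; on a board it covers $m$ slots of the same kind (all left or all right) in $m$ consecutive cells, its gaps may be filled by other tiles. Half-squares, fences, combs are the cases $m=1,2,3$. A tiling covers each slot by exactly one tooth. -}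

module Defs where

open import Data.Nat using (ℕ; zero; suc; _+_; _∸_; _≤ᵇ_; _<ᵇ_; _≡ᵇ_)
open import Data.Bool using (Bool; true; false; _∧_; _∨_)
open import Data.Fin using (Fin; toℕ)
open import Data.Vec using (Vec; lookup)
open import Data.List using (List; allFin; length; filterᵇ; map; concatMap)
open import Data.Bool.ListAction using (all; any)
open import Data.Product using (_×_; _,_; proj₁; proj₂)

trib : ℕ → ℕ
trib 0 = 0
trib 1 = 0
trib 2 = 1
trib (suc (suc (suc k))) = trib (suc (suc k)) + trib (suc k) + trib k

-- Placements of (1/2,1/2;m)-combs (m ∈ {1,2,3}) on ONE kind of slot
-- (all left slots, or all right slots) of an n-board:
-- entry [i][k] is true iff the set of tiles contains a comb with k+1 teeth
-- whose first tooth is in cell i (teeth in cells i, …, i+k).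
SlotTiles : ℕ → Set
SlotTiles n = Vec (Vec Bool 3) n

-- A candidate tiling of an n-board: the set of combs placed on left slots
-- and the set of combs placed on right slots.
Board : ℕ → Set
Board n = SlotTiles n × SlotTiles n

placed : ∀ {n} → SlotTiles n → Fin n → Fin 3 → Bool
placed r i k = lookup (lookup r i) k

teeth : Fin 3 → ℕ
teeth k = suc (toℕ k)

covers : ∀ {n} → Fin n → Fin 3 → ℕ → Bool
covers i k j = (toℕ i ≤ᵇ j) ∧ (j <ᵇ toℕ i + teeth k)

fits : ∀ {n} → Fin n → Fin 3 → Bool
fits {n} i k = toℕ i + teeth k ≤ᵇ n

allPlacements : (n : ℕ) → List (Fin n × Fin 3)
allPlacements n = concatMap (λ i → map (λ k → (i , k)) (allFin 3)) (allFin n)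

combsAt : ∀ {n} → SlotTiles n → ℕ → List (Fin n × Fin 3)
combsAt {n} r j = filterᵇ (λ p → placed r (proj₁ p) (proj₂ p) ∧ covers (proj₁ p) (proj₂ p) j)
                         (allPlacements n)

isSlotTiling : ∀ {n} → SlotTiles n → Bool
isSlotTiling {n} r =
  all (λ p → (placed r (proj₁ p) (proj₂ p)) ⇒ᵇ fits (proj₁ p) (proj₂ p)) (allPlacements n)
  ∧ all (λ j → length (combsAt r (toℕ j)) ≡ᵇ 1) (allFin n)
  where
  _⇒ᵇ_ : Bool → Bool → Bool
  true ⇒ᵇ b = b
  false ⇒ᵇ _ = true

isTiling : ∀ {n} → Board n → Bool
isTiling (l , r) = isSlotTiling l ∧ isSlotTiling r

lastBy : ∀ {n} → ℕ → SlotTiles n → Bool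
lastBy {n} m r = any (λ p → teeth (proj₂ p) ≡ᵇ m) (combsAt r (n ∸ 1))

{-# OPTIONS --safe #-}
module Submission where

-- On one kind of slot the teeth of a comb sit in consecutive cells (its gaps belong to the
-- other kind), so a tiling of the left slots is a left-to-right sequence of combs with 1, 2
-- or 3 teeth, i.e. a composition of n into parts 1, 2, 3, and likewise for the right slots;
-- the two kinds are tiled independently. The tooth in the last cell belongs to the last comb,
-- so the tilings whose last slot is filled by an m-comb are the compositions of n - m followed
-- by the part m, and compositions of k are counted by T (k + 2).

open import Defs
open import Algebra.Bundles using (CommutativeMonoid)
open import Data.Bool using (Bool; true; false; T; T?; _∧_; _∨_)
open import Data.Bool.ListAction using (all; any; and; or)
open import Data.Bool.Properties
  using (∧-comm; ∧-zeroʳ; ∨-assoc; ∨-identityʳ; T-∧; T-irrelevant; ∧-commutativeMonoid)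
open import Algebra.Properties.CommutativeSemigroup
  (CommutativeMonoid.commutativeSemigroup ∧-commutativeMonoid) using (interchange)
open import Data.Empty using (⊥-elim)
open import Data.Fin using (Fin; zero; suc; toℕ)
open import Data.Fin.Properties using (+↔⊎; *↔×)
open import Data.List using (List; []; _∷_; _++_; map; length; filterᵇ; concat; tabulate; allFin)
open import Data.List.Properties
  using (length-++; length-map; map-∘; map-cong; map-tabulate; concat-map; filter-++; ++-identityʳ)
open import Data.Nat using (ℕ; zero; suc; _+_; _*_; _∸_; _≤_; _<_; _≤ᵇ_; _<ᵇ_; _≡ᵇ_; s≤s; _≤?_)
open import Data.Nat.Properties
  using (+-assoc; +-comm; ≤-refl; m≤n⇒m≤1+n; ≰⇒>; m≤n⇒∃[o]m+o≡n; +-∸-comm; m+n∸n≡m; m≤n+m)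
open import Data.Product using (Σ; _×_; _,_; proj₁; proj₂; map₁)
open import Data.Product.Function.NonDependent.Propositional using (_×-↔_)
open import Data.Sum using (_⊎_; inj₁; inj₂)
open import Data.Sum.Function.Propositional using (_⊎-↔_)
open import Data.Vec using (Vec; []; _∷_; lookup)
open import Function using (_∘_)
open import Function.Bundles using (_↔_; mk↔ₛ′; Equivalence)
open import Function.Properties.Inverse using (↔-refl; ↔-sym; ↔-trans)
open import Relation.Binary.PropositionalEquality
open import Relation.Nullary using (¬_; yes; no)
open ≡-Reasoning

module _ {A B : Set} where

  filterᵇ-map : (p : B → Bool) (f : A → B) (xs : List A) →
                filterᵇ p (map f xs) ≡ map f (filterᵇ (p ∘ f) xs)
  filterᵇ-map p f [] = refl
  filterᵇ-map p f (x ∷ xs) with p (f x)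
  ... | true  = cong (f x ∷_) (filterᵇ-map p f xs)
  ... | false = filterᵇ-map p f xs

  any-map : (p : B → Bool) (f : A → B) (xs : List A) → any p (map f xs) ≡ any (p ∘ f) xs
  any-map p f xs = cong or (sym (map-∘ xs))

  all-map : (p : B → Bool) (f : A → B) (xs : List A) → all p (map f xs) ≡ all (p ∘ f) xs
  all-map p f xs = cong and (sym (map-∘ xs))

module _ {A : Set} where

  filterᵇ-cong : {p q : A → Bool} → p ≗ q → (xs : List A) → filterᵇ p xs ≡ filterᵇ q xs
  filterᵇ-cong {p} {q} p≗q [] = refl
  filterᵇ-cong {p} {q} p≗q (x ∷ xs) with p x | q x | p≗q x
  ... | true  | .true  | refl = cong (x ∷_) (filterᵇ-cong p≗q xs)
  ... | false | .false | refl = filterᵇ-cong p≗q xs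

  filterᵇ-none : {p : A → Bool} → (∀ x → p x ≡ false) → (xs : List A) → filterᵇ p xs ≡ []
  filterᵇ-none {p} p≗false [] = refl
  filterᵇ-none {p} p≗false (x ∷ xs) with p x | p≗false x
  ... | .false | refl = filterᵇ-none p≗false xs

  all-cong : {p q : A → Bool} → p ≗ q → (xs : List A) → all p xs ≡ all q xs
  all-cong p≗q xs = cong and (map-cong p≗q xs)

  any-++ : (p : A → Bool) (xs ys : List A) → any p (xs ++ ys) ≡ any p xs ∨ any p ys
  any-++ p []       ys = refl
  any-++ p (x ∷ xs) ys = trans (cong (p x ∨_) (any-++ p xs ys)) (sym (∨-assoc (p x) _ _))

  all-++ : (p : A → Bool) (xs ys : List A) → all p (xs ++ ys) ≡ all p xs ∧ all p ys
  all-++ p []       ys = refl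
  all-++ p (x ∷ xs) ys with p x
  ... | true  = all-++ p xs ys
  ... | false = refl

all-allFin-suc : ∀ {n} (p : Fin (suc n) → Bool) →
                 all p (allFin (suc n)) ≡ p zero ∧ all (p ∘ suc) (allFin n)
all-allFin-suc {n} p = cong (λ xs → p zero ∧ and xs)
  (trans (map-tabulate suc p) (sym (map-tabulate (λ i → i) (p ∘ suc))))

Σ-T-≡ : {A : Set} {p : A → Bool} {x y : A} {px : T (p x)} {py : T (p y)} → x ≡ y →
        _≡_ {A = Σ A (T ∘ p)} (x , px) (y , py)
Σ-T-≡ {px = px} {py} refl = cong (_ ,_) (T-irrelevant px py)

Σ-T-cong : {A : Set} {p q : A → Bool} → p ≗ q → Σ A (T ∘ p) ↔ Σ A (T ∘ q)
Σ-T-cong {p = p} {q} p≗q =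
  mk↔ₛ′ (λ (x , t) → x , subst T (p≗q x) t) (λ (x , t) → x , subst T (sym (p≗q x)) t)
        (λ _ → Σ-T-≡ {p = q} refl) (λ _ → Σ-T-≡ {p = p} refl)

Σ-T-∧↔× : {A B : Set} (p : A → Bool) (q : B → Bool) →
          Σ (A × B) (λ (a , b) → T (p a ∧ q b)) ↔ (Σ A (T ∘ p) × Σ B (T ∘ q))
Σ-T-∧↔× p q = mk↔ₛ′
  (λ ((a , b) , t) → let ta , tb = Equivalence.to T-∧ t in (a , ta) , (b , tb))
  (λ ((a , ta) , (b , tb)) → (a , b) , Equivalence.from T-∧ (ta , tb))
  (λ ((a , ta) , (b , tb)) → cong₂ (λ ta tb → (a , ta) , (b , tb)) (T-irrelevant _ ta) (T-irrelevant _ tb))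
  (λ ((a , b) , t) → cong ((a , b) ,_) (T-irrelevant _ t))

empty↔Fin : {A : Set} {b : ℕ} → ¬ A → b ≡ 0 → A ↔ Fin b
empty↔Fin ¬a refl = mk↔ₛ′ (⊥-elim ∘ ¬a) (λ ()) (λ ()) (⊥-elim ∘ ¬a)

<ᵇ-suc : ∀ m n → (m <ᵇ suc n) ≡ (m ≤ᵇ n)
<ᵇ-suc zero    n = refl
<ᵇ-suc (suc m) n = refl

trib-∸-short : ∀ n t → n < t → trib (n + 2 ∸ t) ≡ 0
trib-∸-short zero    (suc zero)          _         = refl
trib-∸-short zero    (suc (suc zero))    _         = refl
trib-∸-short zero    (suc (suc (suc t))) _         = refl
trib-∸-short (suc n) (suc t)             (s≤s n<t) = trib-∸-short n t n<t

data Composition : ℕ → Set where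
  []    : Composition 0
  one   : ∀ {n} → Composition n → Composition (suc n)
  two   : ∀ {n} → Composition n → Composition (suc (suc n))
  three : ∀ {n} → Composition n → Composition (suc (suc (suc n)))

composition↔Fin : ∀ k → Composition k ↔ Fin (trib (k + 2))
composition↔Fin 0 = mk↔ₛ′ (λ { [] → zero }) (λ { zero → [] }) (λ { zero → refl }) (λ { [] → refl })
composition↔Fin 1 =
  mk↔ₛ′ (λ { (one []) → zero }) (λ { zero → one [] }) (λ { zero → refl }) (λ { (one []) → refl })
composition↔Fin 2 =
  mk↔ₛ′ (λ { (one (one [])) → zero ; (two []) → suc zero })
        (λ { zero → one (one []) ; (suc zero) → two [] })
        (λ { zero → refl ; (suc zero) → refl }) (λ { (one (one [])) → refl ; (two []) → refl })
composition↔Fin (suc (suc (suc k))) =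
  ↔-trans (mk↔ₛ′ to from to∘from from∘to)
  (↔-trans ((composition↔Fin (suc (suc k)) ⊎-↔ composition↔Fin (suc k)) ⊎-↔ composition↔Fin k)
           (↔-sym (↔-trans +↔⊎ (+↔⊎ ⊎-↔ ↔-refl))))
  where
  to : Composition (3 + k) → (Composition (2 + k) ⊎ Composition (1 + k)) ⊎ Composition k
  to (one c)   = inj₁ (inj₁ c)
  to (two c)   = inj₁ (inj₂ c)
  to (three c) = inj₂ c
  from : (Composition (2 + k) ⊎ Composition (1 + k)) ⊎ Composition k → Composition (3 + k)
  from (inj₁ (inj₁ c)) = one c
  from (inj₁ (inj₂ c)) = two c
  from (inj₂ c)        = three c
  to∘from : ∀ x → to (from x) ≡ x
  to∘from (inj₁ (inj₁ c)) = refl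
  to∘from (inj₁ (inj₂ c)) = refl
  to∘from (inj₂ c)        = refl
  from∘to : ∀ c → from (to c) ≡ c
  from∘to (one c)   = refl
  from∘to (two c)   = refl
  from∘to (three c) = refl

Row : Set
Row = Vec Bool 3

_⇒ᵇ_ : Bool → Bool → Bool
true  ⇒ᵇ b = b
false ⇒ᵇ _ = true

rowCombs : Row → ℕ → List (Fin 3)
rowCombs row j = filterᵇ (λ k → lookup row k ∧ (j <ᵇ teeth k)) (allFin 3)

rowFits : Row → ℕ → Bool
rowFits row N = all (λ k → lookup row k ⇒ᵇ (teeth k ≤ᵇ N)) (allFin 3)

rowLastBy : ℕ → Row → ℕ → Bool
rowLastBy m row j = any (λ k → teeth k ≡ᵇ m) (rowCombs row j)

allFit : ∀ {n} → SlotTiles n → Bool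
allFit []                   = true
allFit {suc n} (row ∷ rest) = rowFits row (suc n) ∧ allFit rest

-- carry j counts the teeth that combs starting in earlier cells put j cells ahead of the current one.
coveredOnce : ∀ {n} → SlotTiles n → (ℕ → ℕ) → Bool
coveredOnce []           carry = true
coveredOnce (row ∷ rest) carry =
  (carry 0 + length (rowCombs row 0) ≡ᵇ 1) ∧
  coveredOnce rest (λ j → carry (suc j) + length (rowCombs row (suc j)))

isSlotTiling′ : ∀ {n} → SlotTiles n → Bool
isSlotTiling′ r = coveredOnce r (λ _ → 0) ∧ allFit r

lastBy′ : ∀ {n} → ℕ → SlotTiles n → Bool
lastBy′         m []           = false
lastBy′ {suc n} m (row ∷ rest) = rowLastBy m row n ∨ lastBy′ m rest

allPlacements-suc : ∀ n →
  allPlacements (suc n) ≡ map (zero ,_) (allFin 3) ++ map (map₁ suc) (allPlacements n)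
allPlacements-suc n = cong (map (zero ,_) (allFin 3) ++_) (begin
  concat (map cell (tabulate suc))                     ≡⟨ cong concat (map-tabulate suc cell) ⟩
  concat (tabulate (map (map₁ suc) ∘ cell))
    ≡⟨ cong concat (map-tabulate (λ i → i) (map (map₁ suc) ∘ cell {n})) ⟨
  concat (map (map (map₁ suc) ∘ cell) (allFin n))      ≡⟨ cong concat (map-∘ (allFin n)) ⟩
  concat (map (map (map₁ suc)) (map cell (allFin n)))  ≡⟨ concat-map (map cell (allFin n)) ⟩
  map (map₁ suc) (allPlacements n)                     ∎)
  where
  cell : ∀ {m} → Fin m → List (Fin m × Fin 3)
  cell i = map (i ,_) (allFin 3)

combsAt-∷ : ∀ {n} (row : Row) (rest : SlotTiles n) j → combsAt (row ∷ rest) j ≡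
  map (zero ,_) (rowCombs row j) ++
  map (map₁ suc) (filterᵇ (λ (i , k) → placed rest i k ∧ covers (suc i) k j) (allPlacements n))
combsAt-∷ {n} row rest j = begin
  filterᵇ P (allPlacements (suc n))
    ≡⟨ cong (filterᵇ P) (allPlacements-suc n) ⟩
  filterᵇ P (map (zero ,_) (allFin 3) ++ map (map₁ suc) (allPlacements n))
    ≡⟨ filter-++ (T? ∘ P) (map (zero ,_) (allFin 3)) (map (map₁ suc) (allPlacements n)) ⟩
  filterᵇ P (map (zero ,_) (allFin 3)) ++ filterᵇ P (map (map₁ suc) (allPlacements n))
    ≡⟨ cong₂ _++_ (filterᵇ-map P (zero ,_) (allFin 3)) (filterᵇ-map P (map₁ suc) (allPlacements n)) ⟩
  map (zero ,_) (rowCombs row j) ++ map (map₁ suc) (filterᵇ (P ∘ map₁ suc) (allPlacements n)) ∎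
  where
  P : Fin (suc n) × Fin 3 → Bool
  P (i , k) = placed (row ∷ rest) i k ∧ covers i k j

combsAt-∷-zero : ∀ {n} (row : Row) (rest : SlotTiles n) →
                 combsAt (row ∷ rest) 0 ≡ map (zero ,_) (rowCombs row 0)
combsAt-∷-zero {n} row rest = begin
  combsAt (row ∷ rest) 0
    ≡⟨ combsAt-∷ row rest 0 ⟩
  map (zero ,_) (rowCombs row 0) ++
  map (map₁ suc) (filterᵇ (λ (i , k) → placed rest i k ∧ false) (allPlacements n))
    ≡⟨ cong (λ xs → map (zero ,_) (rowCombs row 0) ++ map (map₁ suc) xs)
            (filterᵇ-none (λ (i , k) → ∧-zeroʳ (placed rest i k)) (allPlacements n)) ⟩
  map (zero ,_) (rowCombs row 0) ++ []
    ≡⟨ ++-identityʳ _ ⟩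
  map (zero ,_) (rowCombs row 0) ∎

combsAt-∷-suc : ∀ {n} (row : Row) (rest : SlotTiles n) j →
  combsAt (row ∷ rest) (suc j) ≡ map (zero ,_) (rowCombs row (suc j)) ++ map (map₁ suc) (combsAt rest j)
combsAt-∷-suc {n} row rest j = trans (combsAt-∷ row rest (suc j))
  (cong (λ xs → map (zero ,_) (rowCombs row (suc j)) ++ map (map₁ suc) xs)
        (filterᵇ-cong (λ (i , k) → cong (λ b → placed rest i k ∧ (b ∧ (j <ᵇ toℕ i + teeth k)))
                                        (<ᵇ-suc (toℕ i) j))
                      (allPlacements n)))

coverage-∷-zero : ∀ {n} (row : Row) (rest : SlotTiles n) →
                  length (combsAt (row ∷ rest) 0) ≡ length (rowCombs row 0)
coverage-∷-zero row rest =
  trans (cong length (combsAt-∷-zero row rest)) (length-map (zero ,_) (rowCombs row 0))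

coverage-∷-suc : ∀ {n} (row : Row) (rest : SlotTiles n) j →
  length (combsAt (row ∷ rest) (suc j)) ≡ length (rowCombs row (suc j)) + length (combsAt rest j)
coverage-∷-suc row rest j = begin
  length (combsAt (row ∷ rest) (suc j))
    ≡⟨ cong length (combsAt-∷-suc row rest j) ⟩
  length (map (zero ,_) (rowCombs row (suc j)) ++ map (map₁ suc) (combsAt rest j))
    ≡⟨ length-++ (map (zero ,_) (rowCombs row (suc j))) ⟩
  length (map (zero ,_) (rowCombs row (suc j))) + length (map (map₁ suc) (combsAt rest j))
    ≡⟨ cong₂ _+_ (length-map (zero ,_) (rowCombs row (suc j))) (length-map (map₁ suc) (combsAt rest j)) ⟩
  length (rowCombs row (suc j)) + length (combsAt rest j) ∎

hasTeeth : ℕ → ∀ {n} → Fin n × Fin 3 → Bool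
hasTeeth m (_ , k) = teeth k ≡ᵇ m

lastBy≡lastBy′ : ∀ {n} m (r : SlotTiles n) → lastBy m r ≡ lastBy′ m r
lastBy≡lastBy′ m [] = refl
lastBy≡lastBy′ m (row ∷ []) = begin
  any (hasTeeth m) (combsAt (row ∷ []) 0)            ≡⟨ cong (any (hasTeeth m)) (combsAt-∷-zero row []) ⟩
  any (hasTeeth m) (map (zero ,_) (rowCombs row 0))  ≡⟨ any-map (hasTeeth m) (zero ,_) (rowCombs row 0) ⟩
  rowLastBy m row 0                                  ≡⟨ ∨-identityʳ _ ⟨
  rowLastBy m row 0 ∨ false                          ∎
lastBy≡lastBy′ {suc (suc n)} m (row ∷ rest@(_ ∷ _)) = begin
  any (hasTeeth m) (combsAt (row ∷ rest) (suc n))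
    ≡⟨ cong (any (hasTeeth m)) (combsAt-∷-suc row rest n) ⟩
  any (hasTeeth m) (map (zero ,_) (rowCombs row (suc n)) ++ map (map₁ suc) (combsAt rest n))
    ≡⟨ any-++ (hasTeeth m) (map (zero ,_) (rowCombs row (suc n))) (map (map₁ suc) (combsAt rest n)) ⟩
  any (hasTeeth m) (map (zero ,_) (rowCombs row (suc n))) ∨ any (hasTeeth m) (map (map₁ suc) (combsAt rest n))
    ≡⟨ cong₂ _∨_ (any-map (hasTeeth m) (zero ,_) (rowCombs row (suc n)))
                 (any-map (hasTeeth m) (map₁ suc) (combsAt rest n)) ⟩
  rowLastBy m row (suc n) ∨ lastBy m rest
    ≡⟨ cong (rowLastBy m row (suc n) ∨_) (lastBy≡lastBy′ m rest) ⟩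
  rowLastBy m row (suc n) ∨ lastBy′ m rest ∎

fitsIfPlaced : ∀ {n} → SlotTiles n → Fin n × Fin 3 → Bool
fitsIfPlaced r (i , k) = placed r i k ⇒ᵇ fits i k

all-fitsIfPlaced≡allFit : ∀ {n} (r : SlotTiles n) → all (fitsIfPlaced r) (allPlacements n) ≡ allFit r
all-fitsIfPlaced≡allFit [] = refl
all-fitsIfPlaced≡allFit {suc n} (row ∷ rest) = begin
  all (fitsIfPlaced (row ∷ rest)) (allPlacements (suc n))
    ≡⟨ cong (all (fitsIfPlaced (row ∷ rest))) (allPlacements-suc n) ⟩
  all (fitsIfPlaced (row ∷ rest)) (map (zero ,_) (allFin 3) ++ map (map₁ suc) (allPlacements n))
    ≡⟨ all-++ (fitsIfPlaced (row ∷ rest)) (map (zero ,_) (allFin 3)) (map (map₁ suc) (allPlacements n)) ⟩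
  rowFits row (suc n) ∧ all (fitsIfPlaced (row ∷ rest)) (map (map₁ suc) (allPlacements n))
    ≡⟨ cong (rowFits row (suc n) ∧_) (all-map (fitsIfPlaced (row ∷ rest)) (map₁ suc) (allPlacements n)) ⟩
  rowFits row (suc n) ∧ all (fitsIfPlaced (row ∷ rest) ∘ map₁ suc) (allPlacements n)
    ≡⟨ cong (rowFits row (suc n) ∧_) (all-cong shifted (allPlacements n)) ⟩
  rowFits row (suc n) ∧ all (fitsIfPlaced rest) (allPlacements n)
    ≡⟨ cong (rowFits row (suc n) ∧_) (all-fitsIfPlaced≡allFit rest) ⟩
  rowFits row (suc n) ∧ allFit rest ∎
  where
  shifted : ∀ p → fitsIfPlaced (row ∷ rest) (map₁ suc p) ≡ fitsIfPlaced rest p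
  shifted (i , k) = cong (placed rest i k ⇒ᵇ_) (<ᵇ-suc (toℕ i + teeth k) n)

all-coverage≡coveredOnce : ∀ {n} (r : SlotTiles n) carry →
  all (λ j → carry (toℕ j) + length (combsAt r (toℕ j)) ≡ᵇ 1) (allFin n) ≡ coveredOnce r carry
all-coverage≡coveredOnce [] carry = refl
all-coverage≡coveredOnce {suc n} (row ∷ rest) carry =
  trans (all-allFin-suc {n} (λ j → carry (toℕ j) + length (combsAt (row ∷ rest) (toℕ j)) ≡ᵇ 1))
        (cong₂ _∧_ (cong (λ c → carry 0 + c ≡ᵇ 1) (coverage-∷-zero row rest))
                   (trans (all-cong shifted (allFin n)) (all-coverage≡coveredOnce rest carry′)))
  where
  carry′ : ℕ → ℕ
  carry′ j = carry (suc j) + length (rowCombs row (suc j))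
  shifted : ∀ j → (carry (suc (toℕ j)) + length (combsAt (row ∷ rest) (suc (toℕ j))) ≡ᵇ 1)
                ≡ (carry′ (toℕ j) + length (combsAt rest (toℕ j)) ≡ᵇ 1)
  shifted j = cong (_≡ᵇ 1) (begin
    carry (suc (toℕ j)) + length (combsAt (row ∷ rest) (suc (toℕ j)))
      ≡⟨ cong (carry (suc (toℕ j)) +_) (coverage-∷-suc row rest (toℕ j)) ⟩
    carry (suc (toℕ j)) + (length (rowCombs row (suc (toℕ j))) + length (combsAt rest (toℕ j)))
      ≡⟨ +-assoc (carry (suc (toℕ j))) _ _ ⟨
    carry′ (toℕ j) + length (combsAt rest (toℕ j)) ∎)

-- The implication in isSlotTiling is local to its definition; it is reached through the predicate it builds.
placedFitsPredicate : ∀ {n} (r : SlotTiles n) → Σ (Fin n × Fin 3 → Bool) λ ok →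
  isSlotTiling r ≡ all ok (allPlacements n) ∧ all (λ j → length (combsAt r (toℕ j)) ≡ᵇ 1) (allFin n)
placedFitsPredicate r = _ , refl

placedFitsPredicate≗fitsIfPlaced : ∀ {n} (r : SlotTiles n) → proj₁ (placedFitsPredicate r) ≗ fitsIfPlaced r
placedFitsPredicate≗fitsIfPlaced r (i , k) with placed r i k
... | true  = refl
... | false = refl

isSlotTiling≡isSlotTiling′ : ∀ {n} (r : SlotTiles n) → isSlotTiling r ≡ isSlotTiling′ r
isSlotTiling≡isSlotTiling′ {n} r = begin
  isSlotTiling r
    ≡⟨ proj₂ (placedFitsPredicate r) ⟩
  all (proj₁ (placedFitsPredicate r)) (allPlacements n) ∧
  all (λ j → length (combsAt r (toℕ j)) ≡ᵇ 1) (allFin n)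
    ≡⟨ cong₂ _∧_ (trans (all-cong (placedFitsPredicate≗fitsIfPlaced r) (allPlacements n))
                        (all-fitsIfPlaced≡allFit r))
                 (all-coverage≡coveredOnce r (λ _ → 0)) ⟩
  allFit r ∧ coveredOnce r (λ _ → 0)
    ≡⟨ ∧-comm (allFit r) _ ⟩
  isSlotTiling′ r ∎

pattern comb₁ = true  ∷ false ∷ false ∷ []
pattern comb₂ = false ∷ true  ∷ false ∷ []
pattern comb₃ = false ∷ false ∷ true  ∷ []
pattern gap   = false ∷ false ∷ false ∷ []

tiles : ∀ {n} → Composition n → SlotTiles n
tiles []        = []
tiles (one c)   = comb₁ ∷ tiles c
tiles (two c)   = comb₂ ∷ gap ∷ tiles c
tiles (three c) = comb₃ ∷ gap ∷ gap ∷ tiles c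

tiles-isSlotTiling′ : ∀ {n} (c : Composition n) → T (isSlotTiling′ (tiles c))
tiles-isSlotTiling′ []        = _
tiles-isSlotTiling′ (one c)   = tiles-isSlotTiling′ c
tiles-isSlotTiling′ (two c)   = tiles-isSlotTiling′ c
tiles-isSlotTiling′ (three c) = tiles-isSlotTiling′ c

covered⇒gap : ∀ row {b c} → T (((1 + length (rowCombs row 0) ≡ᵇ 1) ∧ b) ∧ c) → row ≡ gap
covered⇒gap gap                         _ = refl
covered⇒gap (true  ∷ _     ∷ _    ∷ []) ()
covered⇒gap (false ∷ true  ∷ _    ∷ []) ()
covered⇒gap (false ∷ false ∷ true ∷ []) ()

untile : ∀ {n} (r : SlotTiles n) → T (isSlotTiling′ r) → Σ (Composition n) λ c → tiles c ≡ r
untile [] _ = [] , refl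
untile (comb₁ ∷ r) t = let c , tiles-c = untile r t in one c , cong (comb₁ ∷_) tiles-c
untile (comb₂ ∷ []) ()
untile (comb₂ ∷ row ∷ r) t with covered⇒gap row t
... | refl = let c , tiles-c = untile r t in two c , cong (λ r → comb₂ ∷ gap ∷ r) tiles-c
untile (comb₃ ∷ []) ()
untile (comb₃ ∷ row ∷ r) t with covered⇒gap row t
untile (comb₃ ∷ _ ∷ []) () | refl
untile (comb₃ ∷ _ ∷ row ∷ r) t | refl with covered⇒gap row t
... | refl = let c , tiles-c = untile r t in three c , cong (λ r → comb₃ ∷ gap ∷ gap ∷ r) tiles-c
untile (gap                         ∷ _) ()
untile ((true  ∷ true  ∷ _    ∷ []) ∷ _) ()
untile ((true  ∷ false ∷ true ∷ []) ∷ _) ()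
untile ((false ∷ true  ∷ true ∷ []) ∷ _) ()

untile-tiles : ∀ {n} (c : Composition n) → proj₁ (untile (tiles c) (tiles-isSlotTiling′ c)) ≡ c
untile-tiles []        = refl
untile-tiles (one c)   = cong one (untile-tiles c)
untile-tiles (two c)   = cong two (untile-tiles c)
untile-tiles (three c) = cong three (untile-tiles c)

tilings↔compositions : ∀ {n} (q : SlotTiles n → Bool) →
  Σ (SlotTiles n) (λ r → T (isSlotTiling′ r ∧ q r)) ↔ Σ (Composition n) (λ c → T (q (tiles c)))
tilings↔compositions {n} q = mk↔ₛ′ to from to∘from from∘to
  where
  to : Σ (SlotTiles n) (λ r → T (isSlotTiling′ r ∧ q r)) → Σ (Composition n) (λ c → T (q (tiles c)))
  to (r , t) = let tr , qr = Equivalence.to T-∧ t ; c , tiles-c = untile r tr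
               in c , subst (T ∘ q) (sym tiles-c) qr
  from : Σ (Composition n) (λ c → T (q (tiles c))) → Σ (SlotTiles n) (λ r → T (isSlotTiling′ r ∧ q r))
  from (c , qc) = tiles c , Equivalence.from T-∧ (tiles-isSlotTiling′ c , qc)
  to∘from : ∀ x → to (from x) ≡ x
  to∘from (c , _) =
    Σ-T-≡ (trans (cong (λ t → proj₁ (untile (tiles c) t)) (T-irrelevant _ _)) (untile-tiles c))
  from∘to : ∀ x → from (to x) ≡ x
  from∘to (r , t) = Σ-T-≡ (proj₂ (untile r (proj₁ (Equivalence.to T-∧ t))))

EndingIn : Fin 3 → ℕ → Set
EndingIn p n = Σ (Composition n) λ c → T (lastBy′ (teeth p) (tiles c))

_∷ʳ_ : ∀ {k} → Composition k → (p : Fin 3) → Composition (suc (k + toℕ p))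
[]      ∷ʳ zero           = one []
[]      ∷ʳ suc zero       = two []
[]      ∷ʳ suc (suc zero) = three []
one c   ∷ʳ p              = one (c ∷ʳ p)
two c   ∷ʳ p              = two (c ∷ʳ p)
three c ∷ʳ p              = three (c ∷ʳ p)

∷ʳ-lastBy′ : ∀ {k} (c : Composition k) p → T (lastBy′ (teeth p) (tiles (c ∷ʳ p)))
∷ʳ-lastBy′ []        zero             = _
∷ʳ-lastBy′ []        (suc zero)       = _
∷ʳ-lastBy′ []        (suc (suc zero)) = _
∷ʳ-lastBy′ (one c)   p                = ∷ʳ-lastBy′ c p
∷ʳ-lastBy′ (two c)   p                = ∷ʳ-lastBy′ c p
∷ʳ-lastBy′ (three c) p                = ∷ʳ-lastBy′ c p

module _ {n} {c d : Composition n} where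

  one-injective : one c ≡ one d → c ≡ d
  one-injective refl = refl

  two-injective : two c ≡ two d → c ≡ d
  two-injective refl = refl

  three-injective : three c ≡ three d → c ≡ d
  three-injective refl = refl

∷ʳ-injective : ∀ {k} (c d : Composition k) p → c ∷ʳ p ≡ d ∷ʳ p → c ≡ d
∷ʳ-injective []        []        p _  = refl
∷ʳ-injective (one c)   (one d)   p eq = cong one (∷ʳ-injective c d p (one-injective eq))
∷ʳ-injective (two c)   (two d)   p eq = cong two (∷ʳ-injective c d p (two-injective eq))
∷ʳ-injective (three c) (three d) p eq = cong three (∷ʳ-injective c d p (three-injective eq))
∷ʳ-injective (one _)   (two _)   p ()
∷ʳ-injective (one _)   (three _) p ()
∷ʳ-injective (two _)   (one _)   p ()
∷ʳ-injective (two _)   (three _) p ()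
∷ʳ-injective (three _) (one _)   p ()
∷ʳ-injective (three _) (two _)   p ()

-- Short prefixes come first so that k is split before the composition; the remaining
-- compositions are refuted by evaluating lastBy′ on their tiling.
unsnoc : ∀ k p (c : Composition (suc (k + toℕ p))) → T (lastBy′ (teeth p) (tiles c)) →
         Σ (Composition k) λ c′ → c′ ∷ʳ p ≡ c
unsnoc 0 zero             (one [])               _ = [] , refl
unsnoc 0 (suc zero)       (one (one []))         ()
unsnoc 0 (suc zero)       (two [])               _ = [] , refl
unsnoc 0 (suc (suc zero)) (one (one (one [])))   ()
unsnoc 0 (suc (suc zero)) (one (two []))         ()
unsnoc 0 (suc (suc zero)) (two (one []))         ()
unsnoc 0 (suc (suc zero)) (three [])             _ = [] , refl
unsnoc 1 zero             (two [])               ()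
unsnoc 1 (suc zero)       (two (one []))         ()
unsnoc 1 (suc zero)       (three [])             ()
unsnoc 1 (suc (suc zero)) (two (one (one [])))   ()
unsnoc 1 (suc (suc zero)) (two (two []))         ()
unsnoc 1 (suc (suc zero)) (three (one []))       ()
unsnoc 2 zero             (three [])             ()
unsnoc 2 (suc zero)       (three (one []))       ()
unsnoc 2 (suc (suc zero)) (three (one (one []))) ()
unsnoc 2 (suc (suc zero)) (three (two []))       ()
unsnoc (suc k)             p (one c)   e = let c′ , eq = unsnoc k p c e in one c′ , cong one eq
unsnoc (suc (suc k))       p (two c)   e = let c′ , eq = unsnoc k p c e in two c′ , cong two eq
unsnoc (suc (suc (suc k))) p (three c) e = let c′ , eq = unsnoc k p c e in three c′ , cong three eq

teeth≤length : ∀ {n} p (c : Composition n) → T (lastBy′ (teeth p) (tiles c)) → teeth p ≤ n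
teeth≤length zero             (one [])   _ = ≤-refl
teeth≤length (suc zero)       (two [])   _ = ≤-refl
teeth≤length (suc (suc zero)) (three []) _ = ≤-refl
teeth≤length (suc zero)       (one [])   ()
teeth≤length (suc (suc zero)) (one [])   ()
teeth≤length zero             (two [])   ()
teeth≤length (suc (suc zero)) (two [])   ()
teeth≤length zero             (three []) ()
teeth≤length (suc zero)       (three []) ()
teeth≤length {suc (suc _)}             p (one c)   e = m≤n⇒m≤1+n (teeth≤length p c e)
teeth≤length {suc (suc (suc _))}       p (two c)   e = m≤n⇒m≤1+n (m≤n⇒m≤1+n (teeth≤length p c e))
teeth≤length {suc (suc (suc (suc _)))} p (three c) e =
  m≤n⇒m≤1+n (m≤n⇒m≤1+n (m≤n⇒m≤1+n (teeth≤length p c e)))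

endingIn↔composition : ∀ k p → EndingIn p (suc (k + toℕ p)) ↔ Composition k
endingIn↔composition k p =
  mk↔ₛ′ (λ (c , e) → proj₁ (unsnoc k p c e)) (λ c → c ∷ʳ p , ∷ʳ-lastBy′ c p)
  (λ c → ∷ʳ-injective _ c p (proj₂ (unsnoc k p (c ∷ʳ p) (∷ʳ-lastBy′ c p))))
  (λ (c , e) → Σ-T-≡ (proj₂ (unsnoc k p c e)))

endingIn↔Fin : ∀ n p → EndingIn p n ↔ Fin (trib (n + 2 ∸ teeth p))
endingIn↔Fin n p with teeth p ≤? n
... | no short =
  empty↔Fin (λ (c , e) → short (teeth≤length p c e)) (trib-∸-short n (teeth p) (≰⇒> short))
... | yes (s≤s v≤n) with k , v+k≡n ← m≤n⇒∃[o]m+o≡n v≤n =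
  subst (λ n → EndingIn p n ↔ Fin (trib (n + 2 ∸ teeth p))) (cong suc (trans (+-comm k (toℕ p)) v+k≡n))
        (↔-trans (endingIn↔composition k p)
                 (subst (λ j → Composition k ↔ Fin (trib j)) (sym k+v+2∸v≡k+2) (composition↔Fin k)))
  where
  k+v+2∸v≡k+2 : k + toℕ p + 2 ∸ toℕ p ≡ k + 2
  k+v+2∸v≡k+2 = trans (+-∸-comm 2 (m≤n+m (toℕ p) k)) (cong (_+ 2) (m+n∸n≡m k (toℕ p)))

slotTilingsLastBy↔Fin : ∀ n p →
  Σ (SlotTiles n) (λ r → T (isSlotTiling r ∧ lastBy (teeth p) r)) ↔ Fin (trib (n + 2 ∸ teeth p))
slotTilingsLastBy↔Fin n p =
  ↔-trans (Σ-T-cong (λ r → cong₂ _∧_ (isSlotTiling≡isSlotTiling′ r) (lastBy≡lastBy′ (teeth p) r)))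
  (↔-trans (tilings↔compositions (lastBy′ (teeth p))) (endingIn↔Fin n p))

combWithTeeth : ∀ {m} → 1 ≤ m → m ≤ 3 → Σ (Fin 3) λ p → teeth p ≡ m
combWithTeeth {1} _ _ = zero , refl
combWithTeeth {2} _ _ = suc zero , refl
combWithTeeth {3} _ _ = suc (suc zero) , refl
combWithTeeth {suc (suc (suc (suc _)))} _ (s≤s (s≤s (s≤s ())))

lemma5 : (n m₁ m₂ : ℕ) → 1 ≤ n → 1 ≤ m₁ → m₁ ≤ 3 → 1 ≤ m₂ → m₂ ≤ 3 →
    Σ (Board n) (λ { (l , r) → T (isTiling (l , r) ∧ lastBy m₁ l ∧ lastBy m₂ r) })
      ↔ Fin (trib (n + 2 ∸ m₁) * trib (n + 2 ∸ m₂))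
lemma5 n m₁ m₂ _ 1≤m₁ m₁≤3 1≤m₂ m₂≤3
  with p₁ , refl ← combWithTeeth 1≤m₁ m₁≤3 | p₂ , refl ← combWithTeeth 1≤m₂ m₂≤3 =
  ↔-trans (Σ-T-cong (λ (l , r) → interchange (isSlotTiling l) (isSlotTiling r) (lastBy m₁ l) (lastBy m₂ r)))
  (↔-trans (Σ-T-∧↔× (λ l → isSlotTiling l ∧ lastBy m₁ l) (λ r → isSlotTiling r ∧ lastBy m₂ r))
  (↔-trans (slotTilingsLastBy↔Fin n p₁ ×-↔ slotTilingsLastBy↔Fin n p₂)
           (↔-sym *↔×)))
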